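{- Let $\mathcal{B}$ be a normal $\sqrt{\mathfrak{gl}_n}$-crystal, $i\in[n-2]$, and $b,c\in\mathcal{B}$ with $e_{i+1}(b)=c$. (a) If $\varepsilon_{i+1}(b)$ is odd, then $\mathrm{wt}(c)_i-\mathrm{wt}(c)_{i+1}=\mathrm{wt}(b)_i-\mathrm{wt}(b)_{i+1}$ and $\varepsilon_i(c)=\varepsilon_i(b)$. (b) If $\varepsilon_{i+1}(b)$ is even, then $\mathrm{wt}(c)_i-\mathrm{wt}(c)_{i+1}=\mathrm{wt}(b)_i-\mathrm{wt}(b)_{i+1}-1$ and $\varepsilon_i(c)-\varepsilon_i(b)\in\{0,1,2\}$.
   Context: $[n]=\{1,\dots,n\}$, $\mathbf{e}_k$ standard basis of $\mathbb{Z}^n$. A $\sqrt{\mathfrak{gl}_n}$-crystal is a set $\mathcal{B}$ with $\mathrm{wt}:\mathcal{B}\to\mathbb{Z}^n$ and $e_i,f_i:\mathcal{B}\to\mathcal{B}\sqcup\{0\}$ ($i\in[n-1]$, $e_i(0)=f_i(0)=0$) such that, with $\varepsilon_i(b)=\sup\{k\ge0:e_i^k(b)\neq0\}$ and $\varphi_i(b)=\sup\{k\ge0:f_i^k(b)\ne0\}$: (a) both are finite and $\frac{\varphi_i(b)-\varepsilon_i(b)}{2}=\mathrm{wt}(b)_i-\mathrm{wt}(b)_{i+1}$; (b) $e_i(b)=c$ iff $f_i(c)=b$, and then $\mathrm{wt}(c)-\mathrm{wt}(b)=\mathbf{e}_i$ if $\varepsilon_i(b)$ even, $-\mathbf{e}_{i+1}$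 if odd. Full subcrystals are weakly connected components of the graph with edges $b\to f_i(b)$; isomorphisms preserve weights and operators. Tensor product: weights add; $e_i(b\otimes c)=b\otimes e_i(c)$ if $\varepsilon_i(b)\le\varphi_i(c)$ else $e_i(b)\otimes c$; $f_i(b\otimes c)=b\otimes f_i(c)$ if $\varepsilon_i(b)<\varphi_i(c)$ else $f_i(b)\otimes c$; $b\otimes0=0\otimes c=0$. $\mathbb{1}_n$: one element, weight $0$, zero operators. $\mathsf{SS}_n$: nonempty $S\subseteq[n]$, $\mathrm{wt}(S)=\sum_{j\in S}\mathbf{e}_j$, $e_i(S)=S\cup\{i\}$ if $S\cap\{i,i+1\}=\{i+1\}$, $S\setminus\{i+1\}$ if $S\cap\{i,i+1\}=\{i,i+1\}$, else $0$; $f_i(S)=S\cup\{i+1\}$ if $S\cap\{i,i+1\}=\{i\}$, $S\setminus\{i\}$ if $S\cap\{i,i+1\}=\{i,i+1\}$, else $0$. Normal: every full subcrystal is isomorphic to a full subcrystal of $\mathsf{SS}_n^{\otimes m}$ for some $m\ge0$ ($\mathsf{SS}_n^{\otimes0}=\mathbb{1}_n$). -}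

module Defs where

open import Data.Nat using (ℕ; zero; suc; _≤_; _<_; _%_)
open import Data.Integer as ℤ using (ℤ; +_; -_)
open import Data.Bool using (Bool; true; false; if_then_else_; T; _∨_)
open import Data.Vec using (Vec; []; _∷_; map; zipWith; replicate; foldr)
open import Data.Maybe using (Maybe; just; nothing)
open import Data.Product using (Σ; ∃; _×_; _,_)
open import Data.Sum using (_⊎_)
open import Data.Unit using (⊤)
open import Data.Empty using (⊥)
open import Relation.Nullary using (¬_)
open import Relation.Binary.PropositionalEquality using (_≡_)
open import Relation.Binary.Construct.Closure.Equivalence using (EqClosure)

-- Basic notation.  Indices i are 1-based natural numbers, as in the paper.

InRange : ℕ → ℕ → Set
InRange n i = 1 ≤ i × i < n

-- 1-based coordinate  v_j  of a vector in ℤ^n (only used for 1 ≤ j ≤ n;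
-- returns 0 otherwise)
_‼_ : ∀ {n} → Vec ℤ n → ℕ → ℤ
[] ‼ _ = + 0
(x ∷ v) ‼ zero = + 0
(x ∷ v) ‼ suc zero = x
(x ∷ v) ‼ suc (suc j) = v ‼ suc j

unit : (n : ℕ) → ℕ → Vec ℤ n
unit zero _ = []
unit (suc n) zero = + 0 ∷ replicate n (+ 0)
unit (suc n) (suc zero) = + 1 ∷ replicate n (+ 0)
unit (suc n) (suc (suc k)) = + 0 ∷ unit n (suc k)

_+ᵛ_ : ∀ {n} → Vec ℤ n → Vec ℤ n → Vec ℤ n
_+ᵛ_ = zipWith ℤ._+_

_-ᵛ_ : ∀ {n} → Vec ℤ n → Vec ℤ n → Vec ℤ n
u -ᵛ v = zipWith ℤ._-_ u v

Even Odd : ℕ → Set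
Even k = k % 2 ≡ 0
Odd k = k % 2 ≡ 1

data Iter {C : Set} (R : C → C → Set) : ℕ → C → C → Set where
  here : ∀ {x} → Iter R 0 x x
  step : ∀ {k x y z} → R x y → Iter R k y z → Iter R (suc k) x z

IsSup : {C : Set} → (C → C → Set) → C → ℕ → Set
IsSup R b k = (∃ λ y → Iter R k b y) × ¬ (∃ λ y → Iter R (suc k) b y)

-- graph of a partial function  C → C ⊔ {0}  (0 represented by nothing)
Graph : {C : Set} → (C → Maybe C) → C → C → Set
Graph g x y = g x ≡ just y

-- The operators e_i, f_i are given for all i : ℕ, but
-- only the values for i ∈ [n-1] are ever used (all axioms and all
-- derived notions quantify over i ∈ [n-1] only).
-- ε_i, φ_i are fields, pinned down uniquely by the sup specification
-- (which also encodes their finiteness, axiom (a)).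

record Crystal (n : ℕ) : Set₁ where
  field
    Carrier : Set
    wt : Carrier → Vec ℤ n
    e f : ℕ → Carrier → Maybe Carrier
    ε φ : ℕ → Carrier → ℕ
    ε-sup : ∀ i → InRange n i → ∀ b → IsSup (Graph (e i)) b (ε i b)
    φ-sup : ∀ i → InRange n i → ∀ b → IsSup (Graph (f i)) b (φ i b)
    φ-ε-wt : ∀ i → InRange n i → ∀ b →
      (+ φ i b) ℤ.- (+ ε i b) ≡ (+ 2) ℤ.* ((wt b ‼ i) ℤ.- (wt b ‼ suc i))
    e⇒f : ∀ i → InRange n i → ∀ b c → e i b ≡ just c → f i c ≡ just b
    f⇒e : ∀ i → InRange n i → ∀ b c → f i c ≡ just b → e i b ≡ just c
    e-wt-even : ∀ i → InRange n i → ∀ b c → e i b ≡ just c →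
      Even (ε i b) → wt c -ᵛ wt b ≡ unit n i
    e-wt-odd : ∀ i → InRange n i → ∀ b c → e i b ≡ just c →
      Odd (ε i b) → wt c -ᵛ wt b ≡ map -_ (unit n (suc i))

-- Used to define SS_n^{⊗m} without having to compute ε, φ of tensor
-- products by a closed formula.

record RelCrystal (n : ℕ) : Set₁ where
  field
    Carrier : Set
    wt : Carrier → Vec ℤ n
    E F : ℕ → Carrier → Carrier → Set

toRel : ∀ {n} → Crystal n → RelCrystal n
toRel B = record
  { Carrier = Crystal.Carrier B
  ; wt = Crystal.wt B
  ; E = λ i → Graph (Crystal.e B i)
  ; F = λ i → Graph (Crystal.f B i)
  }

-- Tensor product X ⊗ Y:
--   e_i(b⊗c) = b⊗e_i(c) if ε_i(b) ≤ φ_i(c), else e_i(b)⊗c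
--   f_i(b⊗c) = b⊗f_i(c) if ε_i(b) < φ_i(c), else f_i(b)⊗c
-- with ε_i(b) = sup{k : e_i^k(b) ≠ 0} in X and φ_i(c) = sup{k : f_i^k(c) ≠ 0} in Y.
_⊗_ : ∀ {n} → RelCrystal n → RelCrystal n → RelCrystal n
X ⊗ Y = record
  { Carrier = X.Carrier × Y.Carrier
  ; wt = λ { (b , c) → X.wt b +ᵛ Y.wt c }
  ; E = λ { i (b , c) (b' , c') → Σ ℕ λ k → Σ ℕ λ l →
        IsSup (X.E i) b k × IsSup (Y.F i) c l ×
        ((k ≤ l × b' ≡ b × Y.E i c c') ⊎ (l < k × X.E i b b' × c' ≡ c)) }
  ; F = λ { i (b , c) (b' , c') → Σ ℕ λ k → Σ ℕ λ l →
        IsSup (X.E i) b k × IsSup (Y.F i) c l ×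
        ((k < l × b' ≡ b × Y.F i c c') ⊎ (l ≤ k × X.F i b b' × c' ≡ c)) }
  }
  where
    module X = RelCrystal X
    module Y = RelCrystal Y

𝟙 : (n : ℕ) → RelCrystal n
𝟙 n = record
  { Carrier = ⊤
  ; wt = λ _ → replicate n (+ 0)
  ; E = λ _ _ _ → ⊥
  ; F = λ _ _ _ → ⊥
  }

-- subsets of [n] as characteristic vectors; 1-based membership test
mem : ∀ {n} → Vec Bool n → ℕ → Bool
mem [] _ = false
mem (x ∷ S) zero = false
mem (x ∷ S) (suc zero) = x
mem (x ∷ S) (suc (suc j)) = mem S (suc j)

setBit : ∀ {n} → Vec Bool n → ℕ → Bool → Vec Bool n
setBit [] _ _ = []
setBit (x ∷ S) zero v = x ∷ S
setBit (x ∷ S) (suc zero) v = v ∷ S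
setBit (x ∷ S) (suc (suc j)) v = x ∷ setBit S (suc j) v

nonempty : ∀ {n} → Vec Bool n → Bool
nonempty = foldr _ _∨_ false

SS : (n : ℕ) → RelCrystal n
SS n = record
  { Carrier = Σ (Vec Bool n) (λ S → T (nonempty S))
  ; wt = λ { (S , _) → map (λ b → if b then + 1 else + 0) S }
  ; E = λ { i (S , _) (S' , _) →
        (mem S i ≡ false × mem S (suc i) ≡ true × S' ≡ setBit S i true)
      ⊎ (mem S i ≡ true × mem S (suc i) ≡ true × S' ≡ setBit S (suc i) false) }
  ; F = λ { i (S , _) (S' , _) →
        (mem S i ≡ true × mem S (suc i) ≡ false × S' ≡ setBit S (suc i) true)
      ⊎ (mem S i ≡ true × mem S (suc i) ≡ true × S' ≡ setBit S i false) }
  }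

SS^⊗ : (n m : ℕ) → RelCrystal n
SS^⊗ n zero = 𝟙 n
SS^⊗ n (suc m) = SS^⊗ n m ⊗ SS n

-- Full subcrystals (weakly connected components of the graph with edges
-- b → f_i(b), i ∈ [n-1]) and isomorphisms between them.

Conn : ∀ {n} (X : RelCrystal n) → RelCrystal.Carrier X → RelCrystal.Carrier X → Set
Conn {n} X = EqClosure (λ x y → Σ ℕ λ i → InRange n i × RelCrystal.F X i x y)

-- the relation R' is the image of R under h at the point x, i.e. for
-- partial functions r, r':  h(r(x)) = r'(h(x))  (with h(0) = 0)
Commutes : {C D : Set} → (C → C → Set) → (D → D → Set) → (C → D) → C → Set
Commutes R R' h x =
  (∀ x' → R x x' → R' (h x) (h x')) ×
  (∀ y' → R' (h x) y' → ∃ λ x' → R x x' × h x' ≡ y')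

record ComponentIso {n} (X Y : RelCrystal n)
    (x₀ : RelCrystal.Carrier X) (y₀ : RelCrystal.Carrier Y) : Set where
  private
    module X = RelCrystal X
    module Y = RelCrystal Y
  field
    to : X.Carrier → Y.Carrier
    from : Y.Carrier → X.Carrier
    to-conn : ∀ x → Conn X x₀ x → Conn Y y₀ (to x)
    from-conn : ∀ y → Conn Y y₀ y → Conn X x₀ (from y)
    from-to : ∀ x → Conn X x₀ x → from (to x) ≡ x
    to-from : ∀ y → Conn Y y₀ y → to (from y) ≡ y
    wt-to : ∀ x → Conn X x₀ x → Y.wt (to x) ≡ X.wt x
    e-to : ∀ i → InRange n i → ∀ x → Conn X x₀ x → Commutes (X.E i) (Y.E i) to x
    f-to : ∀ i → InRange n i → ∀ x → Conn X x₀ x → Commutes (X.F i) (Y.F i) to x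

Normal : ∀ {n} → Crystal n → Set
Normal {n} B = ∀ (b : Crystal.Carrier B) →
  Σ ℕ λ m → Σ (RelCrystal.Carrier (SS^⊗ n m)) λ s →
    ComponentIso (toRel B) (SS^⊗ n m) b s

{-# OPTIONS --safe #-}
module Submission where

open import Defs
open import Data.Bool using (Bool; true; false; if_then_else_; T)
open import Data.Bool.Properties using (T-irrelevant; not-¬)
open import Data.Empty using (⊥-elim)
open import Data.Integer as ℤ using (ℤ; +_; -_)
import Data.Integer.Properties as ℤP
open import Data.Integer.Tactic.RingSolver using (solve-∀)
open import Data.Maybe using (just)
open import Data.Nat using (ℕ; zero; suc; _≤_; _<_; _+_; _∸_; z≤n; s≤s; _≤?_)
open import Data.Nat.Properties
open import Data.Product using (∃; _×_; _,_; proj₁; proj₂; map₂)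
open import Data.Sum using (_⊎_; inj₁; inj₂)
open import Function using (_∘_)
open import Data.Vec using (Vec; []; _∷_; map; zipWith; replicate)
open import Relation.Binary.Construct.Closure.ReflexiveTransitive as Star using (_◅_; _◅◅_)
open import Relation.Binary.Construct.Closure.Symmetric using (bwd)
open import Relation.Binary.PropositionalEquality
open import Relation.Binary.Rewriting using (Deterministic)
open import Relation.Nullary using (¬_; yes; no)
open Crystal

-- Normality transports ε_i, e_{i+1} and wt to a component of SS_n^{⊗m}. There ε_i obeys the
-- tensor rule ε_i(x ⊗ S) = ε_i(S) + (ε_i(x) ∸ φ_i(S)), and for a single factor S it only depends
-- on whether i and i+1 lie in S. An e_{i+1}-edge of SS_n^{⊗m} changes exactly one factor S:
-- either it removes i+2, which leaves ε_i unchanged, or it adds i+1, which raises wt_{i+1} by one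
-- and ε_i of the partial product ending in S by one or two. The tensor rule propagates an
-- increase by at most two through the later factors (possibly shrinking it to zero). For odd
-- ε_{i+1}(b) the weight axiom keeps wt_{i+1} fixed, so only the first alternative is possible.

module _ {C : Set} {R : C → C → Set} where

  Iter-prefix : ∀ {j k x z} → j ≤ k → Iter R k x z → ∃ (Iter R j x)
  Iter-prefix z≤n       _           = _ , here
  Iter-prefix (s≤s j≤k) (step r rs) = map₂ (step r) (Iter-prefix j≤k rs)

  IsSup-maximal : ∀ {x j k} → IsSup R x k → ∃ (Iter R j x) → j ≤ k
  IsSup-maximal (_ , ¬longer) (_ , rs) = ≮⇒≥ (λ k<j → ¬longer (Iter-prefix k<j rs))

  IsSup-unique : ∀ {x j k} → IsSup R x j → IsSup R x k → j ≡ k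
  IsSup-unique supj supk =
    ≤-antisym (IsSup-maximal supk (proj₁ supj)) (IsSup-maximal supj (proj₁ supk))

  IsSup-zero : ∀ {x} → (∀ y → ¬ R x y) → IsSup R x 0
  IsSup-zero stuck = (_ , here) , λ { (_ , step r _) → stuck _ r }

  IsSup-suc : Deterministic _≡_ R → ∀ {x y k} → R x y → IsSup R y k → IsSup R x (suc k)
  IsSup-suc det r ((z , rs) , ¬longer) =
    (z , step r rs) , λ { (_ , step r′ rs′) → ¬longer (_ , subst (λ y → Iter R _ y _) (det r′ r) rs′) }

  IsSup-pred : ∀ {x k} → IsSup R x (suc k) → ∃ λ y → R x y × IsSup R y k
  IsSup-pred ((z , step r rs) , ¬longer) =
    _ , r , (z , rs) , λ { (_ , rs′) → ¬longer (_ , step r rs′) }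

module _ {n} (X Y : RelCrystal n) (i : ℕ) where
  private
    module X = RelCrystal X
    module Y = RelCrystal Y
    module X⊗Y = RelCrystal (X ⊗ Y)

  ⊗-E-deterministic : Deterministic _≡_ (X.E i) → Deterministic _≡_ (Y.E i) →
                      Deterministic _≡_ (X⊗Y.E i)
  ⊗-E-deterministic detX detY {x , y} {_ , _} {_ , _}
    (_ , _ , supx , supy , r) (_ , _ , supx′ , supy′ , r′)
    with IsSup-unique supx supx′ | IsSup-unique supy supy′ | r | r′
  ... | refl | refl | inj₁ (_ , refl , s) | inj₁ (_ , refl , s′) = cong (x ,_) (detY s s′)
  ... | refl | refl | inj₂ (_ , s , refl) | inj₂ (_ , s′ , refl) = cong (_, y) (detX s s′)
  ... | refl | refl | inj₁ (k≤l , _)      | inj₂ (l<k , _)       = ⊥-elim (<⇒≱ l<k k≤l)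
  ... | refl | refl | inj₂ (l<k , _)      | inj₁ (k≤l , _)       = ⊥-elim (<⇒≱ l<k k≤l)

  module _ (φY : Y.Carrier → ℕ) (φY-sup : ∀ y → IsSup (Y.F i) y (φY y))
           (detX : Deterministic _≡_ (X.E i)) (detY : Deterministic _≡_ (Y.E i))
           (φY-E : ∀ {y y′} → Y.E i y y′ → φY y′ ≡ suc (φY y)) where

    private
      det : Deterministic _≡_ (X⊗Y.E i)
      det = ⊗-E-deterministic detX detY

      ⊗-E-right : ∀ {x y y′ k} → IsSup (X.E i) x k → k ≤ φY y → Y.E i y y′ →
                  X⊗Y.E i (x , y) (x , y′)
      ⊗-E-right {y = y} supx k≤φ r = _ , _ , supx , φY-sup y , inj₁ (k≤φ , refl , r)

      ⊗-E-left : ∀ {x x′ y k} → IsSup (X.E i) x k → φY y < k → X.E i x x′ →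
                 X⊗Y.E i (x , y) (x′ , y)
      ⊗-E-left {y = y} supx φ<k r = _ , _ , supx , φY-sup y , inj₂ (φ<k , r , refl)

    ⊗-ε-sup-≤ : ∀ {x y k l} → IsSup (X.E i) x k → IsSup (Y.E i) y l → k ≤ φY y →
                IsSup (X⊗Y.E i) (x , y) l
    ⊗-ε-sup-≤ {y = y} {l = zero} supx supy k≤φ = IsSup-zero λ where
      _ (_ , _ , _ , _ , inj₁ (_ , _ , r)) → proj₂ supy (_ , step r here)
      _ (_ , _ , supx′ , supy′ , inj₂ (l<k , _)) →
        <⇒≱ l<k (subst₂ _≤_ (IsSup-unique supx supx′) (IsSup-unique (φY-sup y) supy′) k≤φ)
    ⊗-ε-sup-≤ {l = suc l} supx supy k≤φ with IsSup-pred supy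
    ... | _ , r , supy′ =
      IsSup-suc det (⊗-E-right supx k≤φ r)
        (⊗-ε-sup-≤ supx supy′ (subst (_ ≤_) (sym (φY-E r)) (m≤n⇒m≤1+n k≤φ)))

    ⊗-ε-sup : ∀ {x y k l} → IsSup (X.E i) x k → IsSup (Y.E i) y l →
              IsSup (X⊗Y.E i) (x , y) (l + (k ∸ φY y))
    ⊗-ε-sup-> : ∀ {x y k l} → IsSup (X.E i) x k → IsSup (Y.E i) y l → φY y < k →
                IsSup (X⊗Y.E i) (x , y) (l + (k ∸ φY y))

    ⊗-ε-sup {x} {y} {k} {l} supx supy with k ≤? φY y
    ... | yes k≤φ = subst (IsSup (X⊗Y.E i) (x , y)) l≡l+[k∸φ] (⊗-ε-sup-≤ supx supy k≤φ)
      where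
        l≡l+[k∸φ] : l ≡ l + (k ∸ φY y)
        l≡l+[k∸φ] = sym (trans (cong (_+_ l) (m≤n⇒m∸n≡0 k≤φ)) (+-identityʳ l))
    ... | no k≰φ = ⊗-ε-sup-> supx supy (≰⇒> k≰φ)

    ⊗-ε-sup-> {x} {y} {suc k} {l} supx supy (s≤s φ≤k) with IsSup-pred supx
    ... | _ , r , supx′ =
      subst (IsSup (X⊗Y.E i) (x , y)) shift
        (IsSup-suc det (⊗-E-left supx (s≤s φ≤k) r) (⊗-ε-sup supx′ supy))
      where
        shift : suc (l + (k ∸ φY y)) ≡ l + (suc k ∸ φY y)
        shift = trans (sym (+-suc l _)) (cong (_+_ l) (sym (+-∸-assoc 1 φ≤k)))

m+n∸o≤m+[n∸o] : ∀ m n o → m + n ∸ o ≤ m + (n ∸ o)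
m+n∸o≤m+[n∸o] m n       zero    = ≤-refl
m+n∸o≤m+[n∸o] m zero    (suc o) = m∸n≤m (m + 0) (suc o)
m+n∸o≤m+[n∸o] m (suc n) (suc o) rewrite +-suc m n = m+n∸o≤m+[n∸o] m n o

Increase≤2 : ℕ → ℕ → Set
Increase≤2 a b = a ≤ b × b ≤ 2 + a

Increase≤2-refl : ∀ a → Increase≤2 a a
Increase≤2-refl a = ≤-refl , m≤n+m a 2

Increase≤2-+∸ : ∀ c π {a b} → Increase≤2 a b → Increase≤2 (c + (a ∸ π)) (c + (b ∸ π))
Increase≤2-+∸ c π {a} {b} (a≤b , b≤2+a) = +-monoʳ-≤ c (∸-monoˡ-≤ π a≤b) , (begin
  c + (b ∸ π)       ≤⟨ +-monoʳ-≤ c (∸-monoˡ-≤ π b≤2+a) ⟩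
  c + (2 + a ∸ π)   ≤⟨ +-monoʳ-≤ c (m+n∸o≤m+[n∸o] 2 a π) ⟩
  c + (2 + (a ∸ π)) ≡⟨ trans (+-suc c _) (cong suc (+-suc c _)) ⟩
  2 + (c + (a ∸ π)) ∎)
  where open ≤-Reasoning

zipWith-‼ : ∀ {n} (g : ℤ → ℤ → ℤ) → g (+ 0) (+ 0) ≡ + 0 →
            (u v : Vec ℤ n) → ∀ j → zipWith g u v ‼ j ≡ g (u ‼ j) (v ‼ j)
zipWith-‼ g g00 []      []      _             = sym g00
zipWith-‼ g g00 (_ ∷ u) (_ ∷ v) zero          = sym g00
zipWith-‼ g g00 (_ ∷ u) (_ ∷ v) (suc zero)    = refl
zipWith-‼ g g00 (_ ∷ u) (_ ∷ v) (suc (suc j)) = zipWith-‼ g g00 u v (suc j)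

-ᵛ-‼ : ∀ {n} {u v d : Vec ℤ n} → u -ᵛ v ≡ d → ∀ j → u ‼ j ≡ d ‼ j ℤ.+ v ‼ j
-ᵛ-‼ {u = u} {v} refl j = begin
  u ‼ j                       ≡⟨ x≡[x-y]+y (u ‼ j) (v ‼ j) ⟩
  (u ‼ j ℤ.- v ‼ j) ℤ.+ v ‼ j ≡⟨ cong (ℤ._+ v ‼ j) (sym (zipWith-‼ ℤ._-_ refl u v j)) ⟩
  (u -ᵛ v) ‼ j ℤ.+ v ‼ j      ∎
  where
    open ≡-Reasoning
    x≡[x-y]+y : ∀ x y → x ≡ (x ℤ.- y) ℤ.+ y
    x≡[x-y]+y = solve-∀

replicate-‼ : ∀ n j → replicate n (+ 0) ‼ j ≡ + 0
replicate-‼ zero    _             = refl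
replicate-‼ (suc n) zero          = refl
replicate-‼ (suc n) (suc zero)    = refl
replicate-‼ (suc n) (suc (suc j)) = replicate-‼ n (suc j)

neg-‼ : ∀ {n} (u : Vec ℤ n) j → map -_ u ‼ j ≡ - (u ‼ j)
neg-‼ []      _             = refl
neg-‼ (_ ∷ u) zero          = refl
neg-‼ (_ ∷ u) (suc zero)    = refl
neg-‼ (_ ∷ u) (suc (suc j)) = neg-‼ u (suc j)

unit-‼-≡ : ∀ n j → 1 ≤ j → j ≤ n → unit n j ‼ j ≡ + 1
unit-‼-≡ (suc n) (suc zero)    _ _         = refl
unit-‼-≡ (suc n) (suc (suc j)) _ (s≤s j≤n) = unit-‼-≡ n (suc j) (s≤s z≤n) j≤n

unit-‼-≢ : ∀ n {j k} → j ≢ k → unit n j ‼ k ≡ + 0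
unit-‼-≢ zero                                  _   = refl
unit-‼-≢ (suc n) {zero}        {k}             _   = replicate-‼ (suc n) k
unit-‼-≢ (suc n) {suc zero}    {zero}          _   = refl
unit-‼-≢ (suc n) {suc zero}    {suc zero}      j≢k = ⊥-elim (j≢k refl)
unit-‼-≢ (suc n) {suc zero}    {suc (suc k)}   _   = replicate-‼ n (suc k)
unit-‼-≢ (suc n) {suc (suc j)} {zero}          _   = refl
unit-‼-≢ (suc n) {suc (suc j)} {suc zero}      _   = refl
unit-‼-≢ (suc n) {suc (suc j)} {suc (suc k)}   j≢k = unit-‼-≢ n (j≢k ∘ cong suc)

indicator-‼ : ∀ {n} (S : Vec Bool n) j →
              map (λ b → if b then + 1 else + 0) S ‼ j ≡ (if mem S j then + 1 else + 0)
indicator-‼ []      _             = refl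
indicator-‼ (_ ∷ S) zero          = refl
indicator-‼ (_ ∷ S) (suc zero)    = refl
indicator-‼ (_ ∷ S) (suc (suc j)) = indicator-‼ S (suc j)

mem-setBit-≡ : ∀ {n} (S : Vec Bool n) {j} v → 1 ≤ j → j ≤ n → mem (setBit S j v) j ≡ v
mem-setBit-≡ (_ ∷ S) {suc zero}    v _ _         = refl
mem-setBit-≡ (_ ∷ S) {suc (suc j)} v _ (s≤s j≤n) = mem-setBit-≡ S v (s≤s z≤n) j≤n

mem-setBit-≢ : ∀ {n} (S : Vec Bool n) {j k} v → j ≢ k → mem (setBit S j v) k ≡ mem S k
mem-setBit-≢ []      v _ = refl
mem-setBit-≢ (_ ∷ S) {zero}                 v _   = refl
mem-setBit-≢ (_ ∷ S) {suc zero}  {zero}      v _   = refl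
mem-setBit-≢ (_ ∷ S) {suc zero}  {suc zero}  v j≢k = ⊥-elim (j≢k refl)
mem-setBit-≢ (_ ∷ S) {suc zero}  {suc (suc k)} v _ = refl
mem-setBit-≢ (_ ∷ S) {suc (suc j)} {zero}    v _   = refl
mem-setBit-≢ (_ ∷ S) {suc (suc j)} {suc zero} v _  = refl
mem-setBit-≢ (_ ∷ S) {suc (suc j)} {suc (suc k)} v j≢k = mem-setBit-≢ S v (j≢k ∘ cong suc)

mem⇒nonempty : ∀ {n} (S : Vec Bool n) {j} → mem S j ≡ true → T (nonempty S)
mem⇒nonempty (true  ∷ S) {suc zero}    _   = _
mem⇒nonempty (true  ∷ S) {suc (suc j)} _   = _
mem⇒nonempty (false ∷ S) {suc (suc j)} j∈S = mem⇒nonempty S j∈S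

SS-≡ : ∀ {n} {S S′ : Vec Bool n} {p p′} → S ≡ S′ →
       _≡_ {A = RelCrystal.Carrier (SS n)} (S , p) (S′ , p′)
SS-≡ {p = p} {p′} refl = cong (_ ,_) (T-irrelevant p p′)

SS-E-deterministic : ∀ {n} j → Deterministic _≡_ (RelCrystal.E (SS n) j)
SS-E-deterministic j {S , _} {_ , _} {_ , _} r r′ with mem S j | r | r′
... | _ | inj₁ (refl , _ , refl) | inj₁ (_ , _ , refl) = SS-≡ refl
... | _ | inj₂ (refl , _ , refl) | inj₂ (_ , _ , refl) = SS-≡ refl
... | _ | inj₁ (refl , _)        | inj₂ (() , _)
... | _ | inj₂ (refl , _)        | inj₁ (() , _)

SS-F-deterministic : ∀ {n} j → Deterministic _≡_ (RelCrystal.F (SS n) j)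
SS-F-deterministic j {S , _} {_ , _} {_ , _} r r′ with mem S (suc j) | r | r′
... | _ | inj₁ (_ , refl , refl) | inj₁ (_ , _ , refl) = SS-≡ refl
... | _ | inj₂ (_ , refl , refl) | inj₂ (_ , _ , refl) = SS-≡ refl
... | _ | inj₁ (_ , refl , _)    | inj₂ (_ , () , _)
... | _ | inj₂ (_ , refl , _)    | inj₁ (_ , () , _)

-- The relations of SS n ignore the nonemptiness proofs, so Agda cannot infer the implicit
-- arguments of SS-E-deterministic and SS-F-deterministic; they are passed explicitly.
SS^⊗-E-deterministic : ∀ n m j → Deterministic _≡_ (RelCrystal.E (SS^⊗ n m) j)
SS^⊗-E-deterministic n zero    j ()
SS^⊗-E-deterministic n (suc m) j =
  ⊗-E-deterministic (SS^⊗ n m) (SS n) j (SS^⊗-E-deterministic n m j)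
    (λ {x y z} → SS-E-deterministic j {x} {y} {z})

SS^⊗-wt-‼ : ∀ {n} m x S p j →
  RelCrystal.wt (SS^⊗ n (suc m)) (x , (S , p)) ‼ j ≡
  RelCrystal.wt (SS^⊗ n m) x ‼ j ℤ.+ (if mem S j then + 1 else + 0)
SS^⊗-wt-‼ {n} m x S p j =
  trans (zipWith-‼ ℤ._+_ refl (RelCrystal.wt (SS^⊗ n m) x) _ j)
        (cong (ℤ._+_ (RelCrystal.wt (SS^⊗ n m) x ‼ j)) (indicator-‼ S j))

module SS-at {n} (i : ℕ) (1≤i : 1 ≤ i) (i<n : i < n) where

  private
    module SSₙ = RelCrystal (SS n)

    i≤n : i ≤ n
    i≤n = <⇒≤ i<n

    i≢1+i : i ≢ suc i
    i≢1+i ()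

    1+i≢i : suc i ≢ i
    1+i≢i ()

  εᴮ φᴮ : Bool → Bool → ℕ
  εᴮ _     false = 0
  εᴮ false true  = 2
  εᴮ true  true  = 1
  φᴮ true  false = 2
  φᴮ true  true  = 1
  φᴮ false _     = 0

  εSS φSS : SSₙ.Carrier → ℕ
  εSS (S , _) = εᴮ (mem S i) (mem S (suc i))
  φSS (S , _) = φᴮ (mem S i) (mem S (suc i))

  private
    εSS-sup-0 : ∀ S p → mem S (suc i) ≡ false → IsSup (SSₙ.E i) (S , p) 0
    εSS-sup-0 S p i+1∉S = IsSup-zero λ where
      _ (inj₁ (_ , i+1∈S , _)) → not-¬ i+1∉S i+1∈S
      _ (inj₂ (_ , i+1∈S , _)) → not-¬ i+1∉S i+1∈S

    εSS-sup-1 : ∀ S p → mem S i ≡ true → mem S (suc i) ≡ true → IsSup (SSₙ.E i) (S , p) 1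
    εSS-sup-1 S p i∈S i+1∈S =
      IsSup-suc (λ {x y z} → SS-E-deterministic i {x} {y} {z})
        {y = S′ , mem⇒nonempty S′ i∈S′} (inj₂ (i∈S , i+1∈S , refl))
        (εSS-sup-0 S′ _ (mem-setBit-≡ S false (s≤s z≤n) i<n))
      where
        S′ : Vec Bool n
        S′ = setBit S (suc i) false
        i∈S′ : mem S′ i ≡ true
        i∈S′ = trans (mem-setBit-≢ S false 1+i≢i) i∈S

    εSS-sup-2 : ∀ S p → mem S i ≡ false → mem S (suc i) ≡ true → IsSup (SSₙ.E i) (S , p) 2
    εSS-sup-2 S p i∉S i+1∈S =
      IsSup-suc (λ {x y z} → SS-E-deterministic i {x} {y} {z})
        {y = S′ , mem⇒nonempty S′ i∈S′} (inj₁ (i∉S , i+1∈S , refl))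
        (εSS-sup-1 S′ _ i∈S′ (trans (mem-setBit-≢ S true i≢1+i) i+1∈S))
      where
        S′ : Vec Bool n
        S′ = setBit S i true
        i∈S′ : mem S′ i ≡ true
        i∈S′ = mem-setBit-≡ S true 1≤i i≤n

    φSS-sup-0 : ∀ S p → mem S i ≡ false → IsSup (SSₙ.F i) (S , p) 0
    φSS-sup-0 S p i∉S = IsSup-zero λ where
      _ (inj₁ (i∈S , _)) → not-¬ i∉S i∈S
      _ (inj₂ (i∈S , _)) → not-¬ i∉S i∈S

    φSS-sup-1 : ∀ S p → mem S i ≡ true → mem S (suc i) ≡ true → IsSup (SSₙ.F i) (S , p) 1
    φSS-sup-1 S p i∈S i+1∈S =
      IsSup-suc (λ {x y z} → SS-F-deterministic i {x} {y} {z})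
        {y = S′ , mem⇒nonempty S′ i+1∈S′} (inj₂ (i∈S , i+1∈S , refl))
        (φSS-sup-0 S′ _ (mem-setBit-≡ S false 1≤i i≤n))
      where
        S′ : Vec Bool n
        S′ = setBit S i false
        i+1∈S′ : mem S′ (suc i) ≡ true
        i+1∈S′ = trans (mem-setBit-≢ S false i≢1+i) i+1∈S

    φSS-sup-2 : ∀ S p → mem S i ≡ true → mem S (suc i) ≡ false → IsSup (SSₙ.F i) (S , p) 2
    φSS-sup-2 S p i∈S i+1∉S =
      IsSup-suc (λ {x y z} → SS-F-deterministic i {x} {y} {z})
        {y = S′ , mem⇒nonempty S′ i+1∈S′} (inj₁ (i∈S , i+1∉S , refl))
        (φSS-sup-1 S′ _ (trans (mem-setBit-≢ S true 1+i≢i) i∈S) i+1∈S′)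
      where
        S′ : Vec Bool n
        S′ = setBit S (suc i) true
        i+1∈S′ : mem S′ (suc i) ≡ true
        i+1∈S′ = mem-setBit-≡ S true (s≤s z≤n) i<n

  εSS-sup : ∀ S → IsSup (SSₙ.E i) S (εSS S)
  εSS-sup (S , p) with mem S i in i∈S | mem S (suc i) in i+1∈S
  ... | _     | false = εSS-sup-0 S p i+1∈S
  ... | true  | true  = εSS-sup-1 S p i∈S i+1∈S
  ... | false | true  = εSS-sup-2 S p i∈S i+1∈S

  φSS-sup : ∀ S → IsSup (SSₙ.F i) S (φSS S)
  φSS-sup (S , p) with mem S i in i∈S | mem S (suc i) in i+1∈S
  ... | false | _     = φSS-sup-0 S p i∈S
  ... | true  | true  = φSS-sup-1 S p i∈S i+1∈S
  ... | true  | false = φSS-sup-2 S p i∈S i+1∈S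

  φSS-E : ∀ {S S′} → SSₙ.E i S S′ → φSS S′ ≡ suc (φSS S)
  φSS-E {S , _} (inj₁ (i∉S , i+1∈S , refl))
    rewrite mem-setBit-≡ S true 1≤i i≤n | mem-setBit-≢ S true i≢1+i | i∉S | i+1∈S = refl
  φSS-E {S , _} (inj₂ (i∈S , i+1∈S , refl))
    rewrite mem-setBit-≢ S false 1+i≢i | mem-setBit-≡ S false (s≤s z≤n) i<n | i∈S | i+1∈S = refl

  ε⊗ : ∀ m → RelCrystal.Carrier (SS^⊗ n m) → ℕ
  ε⊗ zero    _       = 0
  ε⊗ (suc m) (x , S) = εSS S + (ε⊗ m x ∸ φSS S)

  ε⊗-sup : ∀ m x → IsSup (RelCrystal.E (SS^⊗ n m) i) x (ε⊗ m x)
  ε⊗-sup zero    _       = IsSup-zero λ _ ()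
  ε⊗-sup (suc m) (x , S) =
    ⊗-ε-sup (SS^⊗ n m) (SS n) i φSS φSS-sup
      (SS^⊗-E-deterministic n m i) (λ {x y z} → SS-E-deterministic i {x} {y} {z})
      (λ {S S′} → φSS-E {S} {S′}) (ε⊗-sup m x) (εSS-sup S)

module e₊₁-on-SS^⊗ {n} (i : ℕ) (1≤i : 1 ≤ i) (2+i≤n : 2 + i ≤ n) where

  open SS-at i 1≤i (<-trans (n<1+n i) 2+i≤n)

  private
    1+i≤n : 1 + i ≤ n
    1+i≤n = <⇒≤ 2+i≤n

    2+i≢i : 2 + i ≢ i
    2+i≢i ()

    2+i≢1+i : 2 + i ≢ 1 + i
    2+i≢1+i ()

    1+i≢i : 1 + i ≢ i
    1+i≢i ()

    wt⊗ : ∀ m → RelCrystal.Carrier (SS^⊗ n m) → Vec ℤ n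
    wt⊗ m = RelCrystal.wt (SS^⊗ n m)

    E₊₁ : ∀ m → RelCrystal.Carrier (SS^⊗ n m) → RelCrystal.Carrier (SS^⊗ n m) → Set
    E₊₁ m = RelCrystal.E (SS^⊗ n m) (suc i)

  ε⊗-setBit-2+i≡ : ∀ m x S p v p′ →
    ε⊗ (suc m) (x , (setBit S (2 + i) v , p′)) ≡ ε⊗ (suc m) (x , (S , p))
  ε⊗-setBit-2+i≡ m x S p v p′ rewrite mem-setBit-≢ S v 2+i≢i | mem-setBit-≢ S v 2+i≢1+i = refl

  ε⊗-setBit-1+i-increase≤2 : ∀ m x S p p′ → mem S (suc i) ≡ false →
    Increase≤2 (ε⊗ (suc m) (x , (S , p))) (ε⊗ (suc m) (x , (setBit S (suc i) true , p′)))
  ε⊗-setBit-1+i-increase≤2 m x S p p′ i+1∉S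
    rewrite mem-setBit-≢ S true 1+i≢i | mem-setBit-≡ S true (s≤s z≤n) 1+i≤n | i+1∉S
    = raise (mem S i) (ε⊗ m x)
    where
      raise : ∀ a e → Increase≤2 (εᴮ a false + (e ∸ φᴮ a false)) (εᴮ a true + (e ∸ φᴮ a true))
      raise false e             = m≤n+m e 2 , ≤-refl
      raise true  zero          = z≤n , s≤s z≤n
      raise true  (suc zero)    = z≤n , s≤s z≤n
      raise true  (suc (suc e)) = m≤n+m e 2 , ≤-refl

  ε⊗-E₊₁-increase≤2 : ∀ m {s t} → E₊₁ m s t → Increase≤2 (ε⊗ m s) (ε⊗ m t)
  ε⊗-E₊₁-increase≤2 (suc m) {x , (S , p)} {_ , (_ , p′)}
    (_ , _ , _ , _ , inj₁ (_ , refl , inj₁ (i+1∉S , _ , refl))) =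
    ε⊗-setBit-1+i-increase≤2 m x S p p′ i+1∉S
  ε⊗-E₊₁-increase≤2 (suc m) {x , (S , p)} {_ , (_ , p′)}
    (_ , _ , _ , _ , inj₁ (_ , refl , inj₂ (_ , _ , refl))) =
    subst (Increase≤2 _) (sym (ε⊗-setBit-2+i≡ m x S p false p′)) (Increase≤2-refl _)
  ε⊗-E₊₁-increase≤2 (suc m) {_ , S} {_ , _} (_ , _ , _ , _ , inj₂ (_ , r , refl)) =
    Increase≤2-+∸ (εSS S) (φSS S) (ε⊗-E₊₁-increase≤2 m r)

  ε⊗-E₊₁-unchanged-or-wt-raised : ∀ m {s t} → E₊₁ m s t →
    ε⊗ m t ≡ ε⊗ m s ⊎ wt⊗ m t ‼ suc i ≡ ℤ.suc (wt⊗ m s ‼ suc i)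
  ε⊗-E₊₁-unchanged-or-wt-raised (suc m) {x , (S , p)} {_ , (_ , p′)}
    (_ , _ , _ , _ , inj₁ (_ , refl , inj₁ (i+1∉S , _ , refl)))
    rewrite SS^⊗-wt-‼ m x (setBit S (suc i) true) p′ (suc i) | SS^⊗-wt-‼ m x S p (suc i)
          | mem-setBit-≡ S true (s≤s z≤n) 1+i≤n | i+1∉S
    = inj₂ (trans (ℤP.+-comm (wt⊗ m x ‼ suc i) (+ 1))
                  (cong ℤ.suc (sym (ℤP.+-identityʳ (wt⊗ m x ‼ suc i)))))
  ε⊗-E₊₁-unchanged-or-wt-raised (suc m) {x , (S , p)} {_ , (_ , p′)}
    (_ , _ , _ , _ , inj₁ (_ , refl , inj₂ (_ , _ , refl))) =
    inj₁ (ε⊗-setBit-2+i≡ m x S p false p′)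
  ε⊗-E₊₁-unchanged-or-wt-raised (suc m) {x , (S , p)} {x′ , _}
    (_ , _ , _ , _ , inj₂ (_ , r , refl))
    with ε⊗-E₊₁-unchanged-or-wt-raised m r
  ... | inj₁ ε-same = inj₁ (cong (λ e → εSS (S , p) + (e ∸ φSS (S , p))) ε-same)
  ... | inj₂ raised rewrite SS^⊗-wt-‼ m x′ S p (suc i) | SS^⊗-wt-‼ m x S p (suc i) | raised
    = inj₂ (ℤP.+-assoc (+ 1) (wt⊗ m x ‼ suc i) _)

module _ {n} {X Y : RelCrystal n} {x₀ y₀} (iso : ComponentIso X Y x₀ y₀)
         {j} (j∈ : InRange n j) (E⇒F : ∀ {x y} → RelCrystal.E X j x y → RelCrystal.F X j y x) where

  private
    module X = RelCrystal X
    module Y = RelCrystal Y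
  open ComponentIso iso

  Conn-E : ∀ {x y} → Conn X x₀ x → X.E j x y → Conn X x₀ y
  Conn-E x₀∼x r = x₀∼x ◅◅ (bwd (j , j∈ , E⇒F r) ◅ Star.ε)

  Iter-to : ∀ {k x z} → Conn X x₀ x → Iter (X.E j) k x z → Iter (Y.E j) k (to x) (to z)
  Iter-to _     here        = here
  Iter-to x₀∼x (step r rs) = step (proj₁ (e-to j j∈ _ x₀∼x) _ r) (Iter-to (Conn-E x₀∼x r) rs)

  Iter-from : ∀ {k x w} → Conn X x₀ x → Iter (Y.E j) k (to x) w → ∃ (Iter (X.E j) k x)
  Iter-from _ here = _ , here
  Iter-from {x = x} x₀∼x (step r rs) with proj₂ (e-to j j∈ x x₀∼x) _ r
  ... | _ , r′ , refl = map₂ (step r′) (Iter-from (Conn-E x₀∼x r′) rs)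

  IsSup-to : ∀ {x k} → Conn X x₀ x → IsSup (X.E j) x k → IsSup (Y.E j) (to x) k
  IsSup-to x₀∼x ((z , rs) , ¬longer) =
    (to z , Iter-to x₀∼x rs) , λ (_ , rs′) → ¬longer (Iter-from x₀∼x rs′)

module _ {n} (B : Crystal n) {j} (j∈ : InRange n j) {b c} (b→c : e B j b ≡ just c) where

  wt-e-odd : Odd (ε B j b) → ∀ k → k ≢ suc j → wt B c ‼ k ≡ wt B b ‼ k
  wt-e-odd odd k k≢1+j = begin
    wt B c ‼ k                                 ≡⟨ -ᵛ-‼ (e-wt-odd B j j∈ b c b→c odd) k ⟩
    map -_ (unit n (suc j)) ‼ k ℤ.+ wt B b ‼ k ≡⟨ cong (ℤ._+ wt B b ‼ k) unit‼k≡0 ⟩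
    + 0 ℤ.+ wt B b ‼ k                         ≡⟨ ℤP.+-identityˡ _ ⟩
    wt B b ‼ k                                 ∎
    where
      open ≡-Reasoning
      unit‼k≡0 : map -_ (unit n (suc j)) ‼ k ≡ + 0
      unit‼k≡0 = trans (neg-‼ (unit n (suc j)) k) (cong -_ (unit-‼-≢ n (k≢1+j ∘ sym)))

  wt-e-even-≢ : Even (ε B j b) → ∀ k → k ≢ j → wt B c ‼ k ≡ wt B b ‼ k
  wt-e-even-≢ even k k≢j =
    trans (-ᵛ-‼ (e-wt-even B j j∈ b c b→c even) k)
      (trans (cong (ℤ._+ wt B b ‼ k) (unit-‼-≢ n (k≢j ∘ sym))) (ℤP.+-identityˡ _))

  wt-e-even-≡ : Even (ε B j b) → wt B c ‼ j ≡ ℤ.suc (wt B b ‼ j)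
  wt-e-even-≡ even =
    trans (-ᵛ-‼ (e-wt-even B j j∈ b c b→c even) j)
      (cong (ℤ._+ wt B b ‼ j) (unit-‼-≡ n j (proj₁ j∈) (<⇒≤ (proj₂ j∈))))

IsZeroOneOrTwo : ℤ → Set
IsZeroOneOrTwo d = (d ≡ + 0) ⊎ (d ≡ + 1) ⊎ (d ≡ + 2)

Increase≤2⇒diff-IsZeroOneOrTwo : ∀ {a b} → Increase≤2 a b → IsZeroOneOrTwo (+ b ℤ.- + a)
Increase≤2⇒diff-IsZeroOneOrTwo {a} {b} (a≤b , b≤2+a) =
  subst IsZeroOneOrTwo (sym b-a≡b∸a)
    (cases (b ∸ a) (m≤n+o⇒m∸n≤o b a (subst (b ≤_) (+-comm 2 a) b≤2+a)))
  where
    b-a≡b∸a : + b ℤ.- + a ≡ + (b ∸ a)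
    b-a≡b∸a = trans (ℤP.m-n≡m⊖n b a) (ℤP.⊖-≥ a≤b)
    cases : ∀ d → d ≤ 2 → IsZeroOneOrTwo (+ d)
    cases 0 _ = inj₁ refl
    cases 1 _ = inj₂ (inj₁ refl)
    cases 2 _ = inj₂ (inj₂ refl)
    cases (suc (suc (suc _))) (s≤s (s≤s ()))

i-suc[j]≡i-j-1 : ∀ x y → x ℤ.- ℤ.suc y ≡ (x ℤ.- y) ℤ.- + 1
i-suc[j]≡i-j-1 x y = x-[o+y]≡[x-y]-o x y (+ 1)
  where
    x-[o+y]≡[x-y]-o : ∀ x y o → x ℤ.- (o ℤ.+ y) ≡ (x ℤ.- y) ℤ.- o
    x-[o+y]≡[x-y]-o = solve-∀

module _ {n} (B : Crystal n) (i : ℕ) (1≤i : 1 ≤ i) (2+i≤n : 2 + i ≤ n)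
         {b c} (b→c : e B (suc i) b ≡ just c)
         (m : ℕ) {s₀} (iso : ComponentIso (toRel B) (SS^⊗ n m) b s₀) where

  private
    i∈ : InRange n i
    i∈ = 1≤i , <-trans (n<1+n i) 2+i≤n
    1+i∈ : InRange n (suc i)
    1+i∈ = s≤s z≤n , 2+i≤n
    open SS-at i 1≤i (proj₂ i∈)
    open e₊₁-on-SS^⊗ i 1≤i 2+i≤n
    open ComponentIso iso

    b∼c : Conn (toRel B) b c
    b∼c = bwd (suc i , 1+i∈ , e⇒f B (suc i) 1+i∈ b c b→c) ◅ Star.ε

    ε≡ε⊗ : ∀ {x} → Conn (toRel B) b x → ε B i x ≡ ε⊗ m (to x)
    ε≡ε⊗ {x} b∼x =
      IsSup-unique (IsSup-to iso i∈ (e⇒f B i i∈ _ _) b∼x (ε-sup B i i∈ x)) (ε⊗-sup m (to x))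

    edge : RelCrystal.E (SS^⊗ n m) (suc i) (to b) (to c)
    edge = proj₁ (e-to (suc i) 1+i∈ b Star.ε) c b→c

  ε-e₊₁-increase≤2 : Increase≤2 (ε B i b) (ε B i c)
  ε-e₊₁-increase≤2 =
    subst₂ Increase≤2 (sym (ε≡ε⊗ Star.ε)) (sym (ε≡ε⊗ b∼c)) (ε⊗-E₊₁-increase≤2 m edge)

  ε-e₊₁-unchanged-or-wt-raised : ε B i c ≡ ε B i b ⊎ wt B c ‼ suc i ≡ ℤ.suc (wt B b ‼ suc i)
  ε-e₊₁-unchanged-or-wt-raised with ε⊗-E₊₁-unchanged-or-wt-raised m edge
  ... | inj₁ same   = inj₁ (trans (ε≡ε⊗ b∼c) (trans same (sym (ε≡ε⊗ Star.ε))))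
  ... | inj₂ raised = inj₂ (subst₂ (λ u v → u ‼ suc i ≡ ℤ.suc (v ‼ suc i))
                                   (wt-to c b∼c) (wt-to b Star.ε) raised)

lemma2p25 : ∀ {n} (B : Crystal n) → Normal B →
    ∀ (i : ℕ) → 1 ≤ i → i + 2 ≤ n →
    ∀ (b c : Carrier B) → e B (suc i) b ≡ just c →
      (Odd (ε B (suc i) b) →
        ((wt B c ‼ i) ℤ.- (wt B c ‼ suc i) ≡ (wt B b ‼ i) ℤ.- (wt B b ‼ suc i))
        × ε B i c ≡ ε B i b)
      × (Even (ε B (suc i) b) →
        ((wt B c ‼ i) ℤ.- (wt B c ‼ suc i) ≡ ((wt B b ‼ i) ℤ.- (wt B b ‼ suc i)) ℤ.- + 1)
        × (((+ ε B i c) ℤ.- (+ ε B i b) ≡ + 0)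
          ⊎ ((+ ε B i c) ℤ.- (+ ε B i b) ≡ + 1)
          ⊎ ((+ ε B i c) ℤ.- (+ ε B i b) ≡ + 2)))
lemma2p25 {n} B normal i 1≤i i+2≤n b c b→c with normal b
... | m , _ , iso = odd-case , even-case
  where
    2+i≤n : 2 + i ≤ n
    2+i≤n = subst (_≤ n) (+-comm i 2) i+2≤n
    1+i∈ : InRange n (suc i)
    1+i∈ = s≤s z≤n , 2+i≤n

    odd-case : Odd (ε B (suc i) b) →
      ((wt B c ‼ i) ℤ.- (wt B c ‼ suc i) ≡ (wt B b ‼ i) ℤ.- (wt B b ‼ suc i)) × ε B i c ≡ ε B i b
    odd-case odd = cong₂ ℤ._-_ (wt-e-odd B 1+i∈ b→c odd i (λ ())) wt₁₊ᵢ-same , ε-same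
      where
        wt₁₊ᵢ-same : wt B c ‼ suc i ≡ wt B b ‼ suc i
        wt₁₊ᵢ-same = wt-e-odd B 1+i∈ b→c odd (suc i) (λ ())
        ε-same : ε B i c ≡ ε B i b
        ε-same with ε-e₊₁-unchanged-or-wt-raised B i 1≤i 2+i≤n b→c m iso
        ... | inj₁ same   = same
        ... | inj₂ raised = ⊥-elim (ℤP.i≢suc[i] (trans (sym wt₁₊ᵢ-same) raised))

    even-case : Even (ε B (suc i) b) →
      ((wt B c ‼ i) ℤ.- (wt B c ‼ suc i) ≡ ((wt B b ‼ i) ℤ.- (wt B b ‼ suc i)) ℤ.- + 1)
      × IsZeroOneOrTwo ((+ ε B i c) ℤ.- (+ ε B i b))
    even-case even =
      trans (cong₂ ℤ._-_ (wt-e-even-≢ B 1+i∈ b→c even i (λ ())) (wt-e-even-≡ B 1+i∈ b→c even))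
            (i-suc[j]≡i-j-1 (wt B b ‼ i) (wt B b ‼ suc i))
      , Increase≤2⇒diff-IsZeroOneOrTwo (ε-e₊₁-increase≤2 B i 1≤i 2+i≤n b→c m iso)
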